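{- Let $n\geqslant 15$ be an integer and $m$ an integer with $2n-1\leqslant m\leqslant 2.4n$, and suppose the numbers $k(k-1)$ $(1\leqslant k\leqslant n)$ are pairwise distinct modulo $m$. Then $p^2\nmid m$ for every odd prime $p$. -}

module Defs where

open import Data.Nat using (ℕ; _*_; _∸_; _%_; _≤_; NonZero)
open import Relation.Binary.PropositionalEquality using (_≡_)

PairwiseDistinctMod : (n m : ℕ) → .{{NonZero m}} → Set
PairwiseDistinctMod n m =
  ∀ j k → 1 ≤ j → j ≤ n → 1 ≤ k → k ≤ n →
  (j * (j ∸ 1)) % m ≡ (k * (k ∸ 1)) % m → j ≡ k

module Submission where

-- Write the odd prime as p = 2h+1 and let k = h+1, so that 2k-1 = p.
-- Then (k+x)(k+x-1) = k(k-1) + x(p+x), and for x = t·p this gives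
--     (k + tp)(k + tp - 1) = k(k-1) + t(t+1)·p².
-- Suppose m = q·p² with q ≥ 1.  Choosing t ≥ 1 with q ∣ t(t+1)
-- (t = q-1 when q ≥ 2, and t = 1 when q = 1) makes the two distinct
-- indices k and k + tp collide modulo m, contradicting pairwise
-- distinctness as soon as k + tp ≤ n.  That inequality follows from
-- 5m ≤ 12n: it suffices that 3(k + tp) ≤ m, which holds for q ≥ 2 and,
-- when q = 1, for every p ≥ 7; the remaining squares 9 and 25 give
-- indices at most 8 ≤ 15 ≤ n.

open import Defs
open import Data.Nat using (ℕ; _*_; _∸_; _≤_; NonZero)
open import Data.Nat.Divisibility using (_∣_)
open import Data.Nat.Primality using (Prime)
open import Relation.Nullary using (¬_; contradiction)

open import Data.Nat using (zero; suc; _+_; _%_; s≤s; z≤n)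
open import Data.Nat.Properties
open import Data.Nat.DivMod using ([m+kn]%n≡m%n)
open import Data.Nat.Divisibility using (divides)
open import Data.Nat.Primality using (¬prime[1])
open import Data.Nat.Tactic.RingSolver using (solve-∀)
open import Data.Product using (∃-syntax; _,_)
open import Data.Sum using (_⊎_; inj₁; inj₂)
open import Relation.Binary.PropositionalEquality

odd-form : ∀ p → ¬ (2 ∣ p) → ∃[ h ] p ≡ suc (2 * h)
odd-form zero          2∤p = contradiction (divides 0 refl) 2∤p
odd-form (suc zero)    2∤p = 0 , refl
odd-form (suc (suc p)) 2∤p+2 with odd-form p 2∤p
  where
    2∤p : ¬ (2 ∣ p)
    2∤p (divides q p≡q*2) = 2∤p+2 (divides (suc q) (cong (2 +_) p≡q*2))
... | h , refl = suc h , cong suc (sym (+-suc (suc h) (h + 0)))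

pronic-shift : ∀ h t →
  suc (h + t * suc (2 * h)) * (h + t * suc (2 * h))
    ≡ suc h * h + t * (suc t * (suc (2 * h) * suc (2 * h)))
pronic-shift = solve-∀

≡-mod : ∀ {x y} c m .{{_ : NonZero m}} → x ≡ y + c * m → x % m ≡ y % m
≡-mod {y = y} c m refl = [m+kn]%n≡m%n y c m

shift-collision : ∀ {n m} .{{_ : NonZero m}} h t c → PairwiseDistinctMod n m →
  suc t * (suc (suc t) * (suc (2 * h) * suc (2 * h))) ≡ c * m →
  ¬ (suc (h + suc t * suc (2 * h)) ≤ n)
shift-collision {n} {m} h t c distinct shift≡cm j≤n =
  m+1+n≢m h (suc-injective (distinct j k (s≤s z≤n) j≤n (s≤s z≤n) k≤n residues))
  where
    j k : ℕ
    j = suc (h + suc t * suc (2 * h))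
    k = suc h
    k≤n : k ≤ n
    k≤n = ≤-trans (s≤s (m≤m+n h _)) j≤n
    residues : (j * (j ∸ 1)) % m ≡ (k * (k ∸ 1)) % m
    residues = ≡-mod c m (trans (pronic-shift h (suc t)) (cong (k * h +_) shift≡cm))

excess⇒≤ : ∀ {a b} c → b ≡ a + c → a ≤ b
excess⇒≤ c refl = m≤m+n _ c

third-fits : ∀ {n m j} → 5 * m ≤ 12 * n → 3 * j ≤ m → j ≤ n
third-fits {n} {m} {j} 5m≤12n 3j≤m = *-cancelˡ-≤ 15 (begin
  15 * j       ≡⟨ *-assoc 5 3 j ⟩
  5 * (3 * j)  ≤⟨ *-monoʳ-≤ 5 3j≤m ⟩
  5 * m        ≤⟨ 5m≤12n ⟩
  12 * n       ≤⟨ *-monoˡ-≤ n (m≤n+m 12 3) ⟩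
  15 * n       ∎)
  where open ≤-Reasoning

-- Case m = q·p², q ≥ 2, p = 2h+1 ≥ 3: the witness h+1+(q-1)p is at most m/3.
multiple-witness-small : ∀ h s →
  3 * suc (suc h + suc s * suc (2 * suc h))
    ≤ (2 + s) * (suc (2 * suc h) * suc (2 * suc h))
multiple-witness-small h s = excess⇒≤ (4 * s * h * h + 6 * s * h + 8 * h * h + 15 * h + 3) (excess h s)
  where
    excess : ∀ h s → (2 + s) * (suc (2 * suc h) * suc (2 * suc h))
               ≡ 3 * suc (suc h + suc s * suc (2 * suc h))
                 + (4 * s * h * h + 6 * s * h + 8 * h * h + 15 * h + 3)
    excess = solve-∀

square-witness-small : ∀ h →
  suc (h + 1 * suc (2 * h)) ≤ 15 ⊎ 3 * suc (h + 1 * suc (2 * h)) ≤ suc (2 * h) * suc (2 * h)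
square-witness-small 0 = inj₁ (≤ᵇ⇒≤ _ 15 _)
square-witness-small 1 = inj₁ (≤ᵇ⇒≤ _ 15 _)
square-witness-small 2 = inj₁ (≤ᵇ⇒≤ _ 15 _)
square-witness-small (suc (suc (suc h))) = inj₂ (excess⇒≤ (4 * h * h + 19 * h + 16) (excess h))
  where
    excess : ∀ h → suc (2 * (3 + h)) * suc (2 * (3 + h))
               ≡ 3 * suc ((3 + h) + 1 * suc (2 * (3 + h))) + (4 * h * h + 19 * h + 16)
    excess = solve-∀

odd-prime-square-collision : ∀ {n} h q .{{_ : NonZero (q * (suc (2 * h) * suc (2 * h)))}} →
  15 ≤ n → Prime (suc (2 * h)) → 5 * (q * (suc (2 * h) * suc (2 * h))) ≤ 12 * n →
  ¬ PairwiseDistinctMod n (q * (suc (2 * h) * suc (2 * h)))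
odd-prime-square-collision h zero {{()}}
odd-prime-square-collision {n} h 1 15≤n _ 5m≤12n distinct =
  shift-collision h 0 2 distinct (double-square h) witness-fits
  where
    double-square : ∀ h → 1 * (2 * (suc (2 * h) * suc (2 * h))) ≡ 2 * (1 * (suc (2 * h) * suc (2 * h)))
    double-square = solve-∀
    witness-fits : suc (h + 1 * suc (2 * h)) ≤ n
    witness-fits with square-witness-small h
    ... | inj₁ j≤15  = ≤-trans j≤15 15≤n
    ... | inj₂ 3j≤p² = third-fits 5m≤12n (≤-trans 3j≤p² (≤-reflexive (sym (*-identityˡ _))))
odd-prime-square-collision zero    (suc (suc s)) _ 1-prime = contradiction 1-prime ¬prime[1]
odd-prime-square-collision (suc h) (suc (suc s)) _ _ 5m≤12n distinct =
  shift-collision (suc h) s (suc s) distinct refl (third-fits 5m≤12n (multiple-witness-small h s))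

lemma2p2 : (n m : ℕ) → .{{_ : NonZero m}} → 15 ≤ n → 2 * n ∸ 1 ≤ m → 5 * m ≤ 12 * n →
           PairwiseDistinctMod n m →
           ∀ p → Prime p → ¬ (2 ∣ p) → ¬ (p * p ∣ m)
lemma2p2 n m 15≤n _ 5m≤12n distinct p p-prime 2∤p p²∣m with odd-form p 2∤p
lemma2p2 n m 15≤n _ 5m≤12n distinct p p-prime 2∤p (divides q refl) | h , refl =
  odd-prime-square-collision h q 15≤n p-prime 5m≤12n distinct
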